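{- Let $n\ge 2$ be an integer and define the integer $k_n$ by $\left\lfloor \frac{1}{\zeta(n)-1} \right\rfloor=2^n-\left\lfloor \left( \frac{4}{3} \right)^n \right\rfloor-k_n$. If $k_n=2$, then $\zeta(n)$ is not of the form $1+\frac{1}{m}$ with $m$ a natural number.
   Context: $\zeta(s)=\sum_{m=1}^{\infty} m^{ -s}$ is the Riemann zeta function and $\lfloor x\rfloor$ is the floor function. -}

module Defs where

open import Data.Nat as ℕ using (ℕ; zero; suc)
open import Data.Nat.Properties using (m^n≢0)
open import Data.Integer using (+_)
open import Data.Rational using (ℚ; 0ℚ; 1ℚ; _+_; _*_; _/_; _≤_; _<_)
open import Data.Product using (Σ; _×_)

zetaTerm : ℕ → ℕ → ℚ
zetaTerm n i = _/_ (+ 1) ((2 ℕ.+ i) ℕ.^ n) {{m^n≢0 (2 ℕ.+ i) n}}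

-- Partial sum  S n N = Σ_{j=2}^{N+1} j^(-n)  (partial sums of ζ(n) - 1).
S : ℕ → ℕ → ℚ
S n zero    = 0ℚ
S n (suc N) = S n N + zetaTerm n N

-- ζ(n) - 1 = x  (as a real number): x is the limit (= supremum, the terms
-- being positive) of the increasing sequence of partial sums S n N.
ZetaMinusOneEq : ℕ → ℚ → Set
ZetaMinusOneEq n x =
  ((N : ℕ) → S n N ≤ x) × ((q : ℚ) → q < x → Σ ℕ λ N → q < S n N)

-- F = ⌊ 1 / (ζ(n) - 1) ⌋, written out: with y = ζ(n) - 1 > 0,
-- F ≤ 1/y < F+1  ⇔  F·y ≤ 1 < (F+1)·y ,
-- i.e. F·S_N ≤ 1 for all N, and 1 < (F+1)·S_N for some N.
IsFloorRecipZetaMinusOne : ℕ → ℕ → Set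
IsFloorRecipZetaMinusOne n F =
  ((N : ℕ) → ((+ F) / 1) * S n N ≤ 1ℚ)
  × (Σ ℕ λ N → 1ℚ < ((+ suc F) / 1) * S n N)

floor4/3pow : ℕ → ℕ
floor4/3pow n = ℕ._/_ (4 ℕ.^ n) (3 ℕ.^ n) {{m^n≢0 3 n}}

{-# OPTIONS --safe #-}
-- If ζ(n) − 1 = 1/m, the floor condition gives m ≤ F = 2^n − ⌊(4/3)^n⌋ − 2, so it
-- suffices to show ζ(n) − 1 < 1/m for every such m. Comparing j^−n with the
-- telescoping (K+2)^−(n−2) (1/(j−1) − 1/j) bounds the tail after the partial sum
-- S_K, so ζ(n) − 1 ≤ S_K + 1/((K+2)^(n−2) (K+1)). For n ≥ 18 the bound with K = 3,
-- 2^−n + 3^−n + 4^−n + 1/(4·5^(n−2)), stays below 1/(2^n − 1 − (4/3)^n) because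
-- 9^n ≤ 4·2^n·5^(n−2); for 2 ≤ n ≤ 17 the bound with K = 4 is checked by computation.
module Submission where

open import Defs
open import Data.Nat using (ℕ; _≤_; _+_; _^_; NonZero)
open import Data.Integer using (+_)
open import Data.Rational using (_/_)
open import Relation.Binary.PropositionalEquality using (_≡_)
open import Relation.Nullary using (¬_)

open import Data.Nat
  using (zero; suc; _*_; _∸_; _<_; _≤′_; ≤′-refl; ≤′-step; z≤n; s≤s; >-nonZero; >-nonZero⁻¹)
open import Data.Nat.Properties
open import Data.Nat.DivMod using (m≡m%n+[m/n]*n; m%n<n)
open import Data.Nat.Tactic.RingSolver using (solve-∀)
import Data.Integer as ℤ
import Data.Integer.Properties as ℤₚ
open import Data.Rational as ℚ using (ℚ; 0ℚ; 1ℚ; toℚᵘ)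
import Data.Rational.Properties as ℚₚ
open import Data.Rational.Unnormalised as ℚᵘ using (mkℚᵘ)
import Data.Rational.Unnormalised.Properties as ℚᵘₚ
open import Data.Product using (Σ; _×_; _,_; proj₁)
open import Relation.Binary.PropositionalEquality
  using (refl; sym; trans; cong; cong₂; subst; subst₂; module ≡-Reasoning)
open import Relation.Nullary using (yes; no)
open import Relation.Nullary.Decidable using (from-yes)

toℚᵘ-/ : ∀ a b → toℚᵘ ((+ a) / suc b) ℚᵘ.≃ mkℚᵘ (+ a) b
toℚᵘ-/ a b = ℚₚ.toℚᵘ-fromℚᵘ (mkℚᵘ (+ a) b)

*≤*⇒/≤/ : ∀ a b c d .{{_ : NonZero b}} .{{_ : NonZero d}} →
          a * d ≤ c * b → (+ a) / b ℚ.≤ (+ c) / d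
*≤*⇒/≤/ a (suc b) c (suc d) ad≤cb = ℚₚ.toℚᵘ-cancel-≤
  (ℚᵘₚ.≤-respˡ-≃ (ℚᵘₚ.≃-sym (toℚᵘ-/ a b))
    (ℚᵘₚ.≤-respʳ-≃ (ℚᵘₚ.≃-sym (toℚᵘ-/ c d))
      (ℚᵘ.*≤* (subst₂ ℤ._≤_ (ℤₚ.pos-* a (suc d)) (ℤₚ.pos-* c (suc b)) (ℤ.+≤+ ad≤cb)))))

*<*⇒/</ : ∀ a b c d .{{_ : NonZero b}} .{{_ : NonZero d}} →
          a * d < c * b → (+ a) / b ℚ.< (+ c) / d
*<*⇒/</ a (suc b) c (suc d) ad<cb = ℚₚ.toℚᵘ-cancel-<
  (ℚᵘₚ.<-respˡ-≃ (ℚᵘₚ.≃-sym (toℚᵘ-/ a b))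
    (ℚᵘₚ.<-respʳ-≃ (ℚᵘₚ.≃-sym (toℚᵘ-/ c d))
      (ℚᵘ.*<* (subst₂ ℤ._<_ (ℤₚ.pos-* a (suc d)) (ℤₚ.pos-* c (suc b)) (ℤ.+<+ ad<cb)))))

/</⇒*<* : ∀ a b c d .{{_ : NonZero b}} .{{_ : NonZero d}} →
          (+ a) / b ℚ.< (+ c) / d → a * d < c * b
/</⇒*<* a (suc b) c (suc d) a/b<c/d = ℤₚ.drop‿+<+
  (subst₂ ℤ._<_ (sym (ℤₚ.pos-* a (suc d))) (sym (ℤₚ.pos-* c (suc b)))
    (ℚᵘₚ.drop-*<* (ℚᵘₚ.<-respˡ-≃ (toℚᵘ-/ a b)
      (ℚᵘₚ.<-respʳ-≃ (toℚᵘ-/ c d) (ℚₚ.toℚᵘ-mono-< a/b<c/d)))))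

/+/ : ∀ a b c d .{{_ : NonZero b}} .{{_ : NonZero d}} →
      (+ a) / b ℚ.+ (+ c) / d ≡ _/_ (+ (a * d + c * b)) (b * d) {{m*n≢0 b d}}
/+/ a (suc b) c (suc d) = ℚₚ.toℚᵘ-injective (ℚᵘₚ.≃-trans
  (ℚₚ.toℚᵘ-homo-+ ((+ a) / suc b) ((+ c) / suc d))
  (ℚᵘₚ.≃-trans (ℚᵘₚ.+-cong (toℚᵘ-/ a b) (toℚᵘ-/ c d))
    (ℚᵘₚ.≃-trans (ℚᵘₚ.≃-reflexive (cong (λ z → mkℚᵘ z _) numerator))
                 (ℚᵘₚ.≃-sym (toℚᵘ-/ _ _)))))
  where
  numerator : + a ℤ.* + suc d ℤ.+ + c ℤ.* + suc b ≡ + (a * suc d + c * suc b)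
  numerator = trans (cong₂ ℤ._+_ (sym (ℤₚ.pos-* a (suc d))) (sym (ℤₚ.pos-* c (suc b))))
                    (sym (ℤₚ.pos-+ (a * suc d) (c * suc b)))

/*/ : ∀ a b c d .{{_ : NonZero b}} .{{_ : NonZero d}} →
      ((+ a) / b) ℚ.* ((+ c) / d) ≡ _/_ (+ (a * c)) (b * d) {{m*n≢0 b d}}
/*/ a (suc b) c (suc d) = ℚₚ.toℚᵘ-injective (ℚᵘₚ.≃-trans
  (ℚₚ.toℚᵘ-homo-* ((+ a) / suc b) ((+ c) / suc d))
  (ℚᵘₚ.≃-trans (ℚᵘₚ.*-cong (toℚᵘ-/ a b) (toℚᵘ-/ c d))
    (ℚᵘₚ.≃-trans (ℚᵘₚ.≃-reflexive (cong (λ z → mkℚᵘ z _) (sym (ℤₚ.pos-* a c))))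
                 (ℚᵘₚ.≃-sym (toℚᵘ-/ _ _)))))

0≤/ : ∀ a b .{{_ : NonZero b}} → 0ℚ ℚ.≤ (+ a) / b
0≤/ a b = *≤*⇒/≤/ 0 1 a b z≤n

p≤p+q : ∀ p {q} → 0ℚ ℚ.≤ q → p ℚ.≤ p ℚ.+ q
p≤p+q p 0≤q = ℚₚ.≤-trans (ℚₚ.≤-reflexive (sym (ℚₚ.+-identityʳ p))) (ℚₚ.+-monoʳ-≤ p 0≤q)

recip-telescope : ∀ c L P .{{_ : NonZero c}} .{{_ : NonZero L}} .{{_ : NonZero P}} →
                  c * suc L * L ≤ P →
                  (+ 1) / P ℚ.+ _/_ (+ 1) (c * suc L) {{m*n≢0 c (suc L)}}
                    ℚ.≤ _/_ (+ 1) (c * L) {{m*n≢0 c L}}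
recip-telescope c L P cL[L+1]≤P =
  subst (ℚ._≤ (+ 1) / (c * L)) (sym (/+/ 1 P 1 (c * suc L)))
    (*≤*⇒/≤/ (1 * (c * suc L) + 1 * P) (P * (c * suc L)) 1 (c * L) (begin
      (1 * (c * suc L) + 1 * P) * (c * L) ≡⟨ expand c L P ⟩
      c * (c * suc L * L) + P * (c * L)   ≤⟨ +-monoˡ-≤ _ (*-monoʳ-≤ c cL[L+1]≤P) ⟩
      c * P + P * (c * L)                 ≡⟨ collect c L P ⟩
      1 * (P * (c * suc L))               ∎))
  where
  open ≤-Reasoning
  instance
    c[L+1]≢0 : NonZero (c * suc L)
    c[L+1]≢0 = m*n≢0 c (suc L)
    cL≢0 : NonZero (c * L)
    cL≢0 = m*n≢0 c L
    Pc[L+1]≢0 : NonZero (P * (c * suc L))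
    Pc[L+1]≢0 = m*n≢0 P (c * suc L)
  expand : ∀ c L P → (1 * (c * suc L) + 1 * P) * (c * L) ≡ c * (c * suc L * L) + P * (c * L)
  expand = solve-∀
  collect : ∀ c L P → c * P + P * (c * L) ≡ 1 * (P * (c * suc L))
  collect = solve-∀

0≤zetaTerm : ∀ n i → 0ℚ ℚ.≤ zetaTerm n i
0≤zetaTerm n i = 0≤/ 1 ((2 + i) ^ n) {{m^n≢0 (2 + i) n}}

S-mono-≤ : ∀ n {N M} → N ≤ M → S n N ℚ.≤ S n M
S-mono-≤ n N≤M = go (≤⇒≤′ N≤M)
  where
  go : ∀ {N M} → N ≤′ M → S n N ℚ.≤ S n M
  go ≤′-refl       = ℚₚ.≤-refl
  go (≤′-step N≤M) = ℚₚ.≤-trans (go N≤M) (p≤p+q _ (0≤zetaTerm n _))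

-- For K ≤ N, tailBound k K N bounds the tail Σ_{j ≥ N+2} j^−(k+2) of ζ(k+2), so that
-- zetaUpper k K N bounds ζ(k+2) − 1.
tailBound : ℕ → ℕ → ℕ → ℚ
tailBound k K N = _/_ (+ 1) ((2 + K) ^ k * suc N) {{m*n≢0 _ _ {{m^n≢0 (2 + K) k}}}}

zetaUpper : ℕ → ℕ → ℕ → ℚ
zetaUpper k K N = S (2 + k) N ℚ.+ tailBound k K N

tailBound-step : ∀ k K N → K ≤ N →
                 zetaTerm (2 + k) N ℚ.+ tailBound k K (suc N) ℚ.≤ tailBound k K N
tailBound-step k K N K≤N =
  recip-telescope ((2 + K) ^ k) (suc N) ((2 + N) ^ (2 + k))
                  {{m^n≢0 (2 + K) k}} {{_}} {{m^n≢0 (2 + N) (2 + k)}} (begin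
    (2 + K) ^ k * (2 + N) * suc N
      ≤⟨ *-monoˡ-≤ (suc N) (*-monoˡ-≤ (2 + N) (^-monoˡ-≤ k (+-monoʳ-≤ 2 K≤N))) ⟩
    (2 + N) ^ k * (2 + N) * suc N
      ≤⟨ *-monoʳ-≤ ((2 + N) ^ k * (2 + N)) (n≤1+n (suc N)) ⟩
    (2 + N) ^ k * (2 + N) * (2 + N)
      ≡⟨ reassoc ((2 + N) ^ k) (2 + N) ⟩
    (2 + N) ^ (2 + k) ∎)
  where
  open ≤-Reasoning
  reassoc : ∀ x y → x * y * y ≡ y * (y * x)
  reassoc = solve-∀

zetaUpper-step : ∀ k K N → K ≤ N → zetaUpper k K (suc N) ℚ.≤ zetaUpper k K N
zetaUpper-step k K N K≤N = ℚₚ.≤-trans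
  (ℚₚ.≤-reflexive (ℚₚ.+-assoc (S (2 + k) N) (zetaTerm (2 + k) N) (tailBound k K (suc N))))
  (ℚₚ.+-monoʳ-≤ (S (2 + k) N) (tailBound-step k K N K≤N))

zetaUpper-antitone : ∀ k K {N M} → K ≤ N → N ≤ M → zetaUpper k K M ℚ.≤ zetaUpper k K N
zetaUpper-antitone k K K≤N N≤M = go K≤N (≤⇒≤′ N≤M)
  where
  go : ∀ {N M} → K ≤ N → N ≤′ M → zetaUpper k K M ℚ.≤ zetaUpper k K N
  go K≤N ≤′-refl        = ℚₚ.≤-refl
  go K≤N (≤′-step N≤′M) =
    ℚₚ.≤-trans (zetaUpper-step k K _ (≤-trans K≤N (≤′⇒≤ N≤′M))) (go K≤N N≤′M)

S≤zetaUpper : ∀ k K N → S (2 + k) N ℚ.≤ zetaUpper k K K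
S≤zetaUpper k K N = ℚₚ.≤-trans (S-mono-≤ (2 + k) (m≤n+m N K))
  (ℚₚ.≤-trans (p≤p+q (S (2 + k) (K + N)) (0≤/ 1 _ {{m*n≢0 _ _ {{m^n≢0 (2 + K) k}}}}))
              (zetaUpper-antitone k K ≤-refl (m≤m+n K N)))

ZetaMinusOneBelow : ℕ → ℚ → Set
ZetaMinusOneBelow n x = Σ ℚ λ q → ((N : ℕ) → S n N ℚ.≤ q) × q ℚ.< x

ZetaMinusOneEq⇒¬Below : ∀ {n x} → ZetaMinusOneEq n x → ¬ ZetaMinusOneBelow n x
ZetaMinusOneEq⇒¬Below (_ , approx) (q , S≤q , q<x) with approx q q<x
... | N , q<S = ℚₚ.<-irrefl refl (ℚₚ.<-≤-trans q<S (S≤q N))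

IsFloorRecip⇒≥ : ∀ {n F m} .{{_ : NonZero m}} → IsFloorRecipZetaMinusOne n F →
                 ((N : ℕ) → S n N ℚ.≤ (+ 1) / m) → m ≤ F
IsFloorRecip⇒≥ {n} {F} {m} (_ , N , 1<[F+1]S) S≤1/m =
  m<1+n⇒m≤n (subst₂ _<_ (trans (*-identityˡ (1 * m)) (*-identityˡ m))
                        (trans (*-identityʳ (suc F * 1)) (*-identityʳ (suc F)))
                        (/</⇒*<* 1 1 (suc F * 1) (1 * m) 1<[F+1]/m))
  where
  instance
    1m≢0 : NonZero (1 * m)
    1m≢0 = m*n≢0 1 m
    [F+1]≥0 : ℚ.NonNegative ((+ suc F) / 1)
    [F+1]≥0 = ℚₚ.normalize-nonNeg (suc F) 1
  1<[F+1]/m : 1ℚ ℚ.< (+ (suc F * 1)) / (1 * m)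
  1<[F+1]/m = ℚₚ.<-≤-trans 1<[F+1]S
    (subst (((+ suc F) / 1) ℚ.* S n N ℚ.≤_) (/*/ (suc F) 1 1 m)
      (ℚₚ.*-monoˡ-≤-nonNeg ((+ suc F) / 1) (S≤1/m N)))

4^n<suc[floor4/3pow]*3^n : ∀ n → 4 ^ n < suc (floor4/3pow n) * 3 ^ n
4^n<suc[floor4/3pow]*3^n n =
  subst (_< suc (floor4/3pow n) * 3 ^ n) (sym (m≡m%n+[m/n]*n (4 ^ n) (3 ^ n)))
    (+-monoˡ-< (floor4/3pow n * 3 ^ n) (m%n<n (4 ^ n) (3 ^ n)))
  where
  instance
    3^n≢0 : NonZero (3 ^ n)
    3^n≢0 = m^n≢0 3 n

4^n≡2^n*2^n : ∀ n → 4 ^ n ≡ 2 ^ n * 2 ^ n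
4^n≡2^n*2^n zero    = refl
4^n≡2^n*2^n (suc n) = trans (cong (4 *_) (4^n≡2^n*2^n n)) (square (2 ^ n))
  where
  square : ∀ x → 4 * (x * x) ≡ 2 * x * (2 * x)
  square = solve-∀

3^n*3^n≤2^n*[5^k*4] : ∀ {k} → 16 ≤ k →
                      3 ^ (2 + k) * 3 ^ (2 + k) ≤ 2 ^ (2 + k) * (5 ^ k * 4)
3^n*3^n≤2^n*[5^k*4] 16≤k = go (≤⇒≤′ 16≤k)
  where
  step : ∀ p q r → p * p ≤ q * (r * 4) → 3 * p * (3 * p) ≤ 2 * q * (5 * r * 4)
  step p q r p²≤qr = begin
    3 * p * (3 * p)     ≡⟨ nine p ⟩
    9 * (p * p)         ≤⟨ *-monoʳ-≤ 9 p²≤qr ⟩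
    9 * (q * (r * 4))   ≤⟨ *-monoˡ-≤ (q * (r * 4)) (n≤1+n 9) ⟩
    10 * (q * (r * 4))  ≡⟨ ten q r ⟩
    2 * q * (5 * r * 4) ∎
    where
    open ≤-Reasoning
    nine : ∀ p → 3 * p * (3 * p) ≡ 9 * (p * p)
    nine = solve-∀
    ten : ∀ q r → 10 * (q * (r * 4)) ≡ 2 * q * (5 * r * 4)
    ten = solve-∀
  go : ∀ {k} → 16 ≤′ k → 3 ^ (2 + k) * 3 ^ (2 + k) ≤ 2 ^ (2 + k) * (5 ^ k * 4)
  go ≤′-refl            = from-yes (3 ^ 18 * 3 ^ 18 ≤? 2 ^ 18 * (5 ^ 16 * 4))
  go (≤′-step {k} 16≤k) = step (3 ^ (2 + k)) (2 ^ (2 + k)) (5 ^ k) (go 16≤k)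

-- For q = X/Y the last hypothesis says q (A − 1 − C/B) ≤ 1, and the first two give
-- m < A − 1 − C/B.
*<-from-floor-gap : ∀ {A B C X Y m f} → 0 < X → m + f + 2 ≤ A → C < suc f * B →
                    X * (A * B) ≤ Y * B + X * (C + B) → X * m < Y
*<-from-floor-gap {A} {B} {C} {X} {Y} {m} {f} X>0 gap C<[1+f]B XAB≤ =
  *-cancelʳ-< B (X * m) Y (+-cancelʳ-< (X * (C + B)) (X * m * B) (Y * B) (begin-strict
    X * m * B + X * (C + B)       ≡⟨ distrib X m B C ⟩
    X * (m * B + (C + B))
      <⟨ *-monoʳ-< X (+-monoʳ-< (m * B) (+-monoˡ-< B C<[1+f]B)) ⟩
    X * (m * B + (suc f * B + B)) ≡⟨ cong (X *_) (collect m f B) ⟩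
    X * ((m + f + 2) * B)         ≤⟨ *-monoʳ-≤ X (*-monoˡ-≤ B gap) ⟩
    X * (A * B)                   ≤⟨ XAB≤ ⟩
    Y * B + X * (C + B)           ∎))
  where
  open ≤-Reasoning
  instance
    X≢0 : NonZero X
    X≢0 = >-nonZero X>0
  distrib : ∀ X m B C → X * m * B + X * (C + B) ≡ X * (m * B + (C + B))
  distrib = solve-∀
  collect : ∀ m f B → m * B + (suc f * B + B) ≡ (m + f + 2) * B
  collect = solve-∀

-- 1/A + 1/B + 1/A² + 1/E = recipSumNumer A B E / recipSumDenom A B E, in the shape
-- produced by /+/.
recipSumNumer : ℕ → ℕ → ℕ → ℕ
recipSumNumer A B E = ((1 * B + 1 * A) * (A * A) + 1 * (A * B)) * E + 1 * (A * B * (A * A))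

recipSumDenom : ℕ → ℕ → ℕ → ℕ
recipSumDenom A B E = A * B * (A * A) * E

-- The difference of the two sides of recipSumNumer-bound is A⁴ (A E − B²) plus terms
-- with positive coefficients.
recipSumNumer-expansion : ∀ A B E →
  let X = ((1 * B + 1 * A) * (A * A) + 1 * (A * B)) * E + 1 * (A * B * (A * A))
      Y = A * B * (A * A) * E in
  X * (A * B) + A * A * A * A * (A * E)
    + (2 * (A * A * A * B * E) + A * A * A * A * A * B + A * B * B * E + A * A * A * B * B)
  ≡ Y * B + X * (A * A + B) + A * A * A * A * (B * B)
recipSumNumer-expansion = solve-∀

recipSumNumer-bound : ∀ A B E → B * B ≤ A * E →
                      let X = recipSumNumer A B E ; Y = recipSumDenom A B E in
                      X * (A * B) ≤ Y * B + X * (A * A + B)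
recipSumNumer-bound A B E B²≤AE = +-cancelʳ-≤ (A⁴ * (B * B)) _ _ (begin
    X * (A * B) + A⁴ * (B * B)     ≤⟨ +-monoʳ-≤ (X * (A * B)) (*-monoʳ-≤ A⁴ B²≤AE) ⟩
    X * (A * B) + A⁴ * (A * E)     ≤⟨ m≤m+n _ _ ⟩
    X * (A * B) + A⁴ * (A * E) + _ ≡⟨ recipSumNumer-expansion A B E ⟩
    recipSumDenom A B E * B + X * (A * A + B) + A⁴ * (B * B) ∎)
  where
  open ≤-Reasoning
  X : ℕ
  X = recipSumNumer A B E
  A⁴ : ℕ
  A⁴ = A * A * A * A

module LargeExponent (k : ℕ) where

  n : ℕ
  n = 2 + k

  A : ℕ
  A = 2 ^ n

  B : ℕ
  B = 3 ^ n

  E : ℕ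
  E = 5 ^ k * 4

  X : ℕ
  X = recipSumNumer A B E

  Y : ℕ
  Y = recipSumDenom A B E

  instance
    A≢0 : NonZero A
    A≢0 = m^n≢0 2 n
    B≢0 : NonZero B
    B≢0 = m^n≢0 3 n
    4^n≢0 : NonZero (4 ^ n)
    4^n≢0 = m^n≢0 4 n
    E≢0 : NonZero E
    E≢0 = m*n≢0 (5 ^ k) 4 {{m^n≢0 5 k}}
    A²≢0 : NonZero (A * A)
    A²≢0 = m*n≢0 A A
    AB≢0 : NonZero (A * B)
    AB≢0 = m*n≢0 A B
    ABA²≢0 : NonZero (A * B * (A * A))
    ABA²≢0 = m*n≢0 (A * B) (A * A)
    Y≢0 : NonZero Y
    Y≢0 = m*n≢0 (A * B * (A * A)) E

  zetaUpper≡X/Y : zetaUpper k 3 3 ≡ (+ X) / Y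
  zetaUpper≡X/Y = begin
    (((0ℚ ℚ.+ (+ 1) / A) ℚ.+ (+ 1) / B) ℚ.+ (+ 1) / 4 ^ n) ℚ.+ (+ 1) / E
      ≡⟨ cong (λ x → ((x ℚ.+ (+ 1) / B) ℚ.+ (+ 1) / 4 ^ n) ℚ.+ (+ 1) / E)
              (ℚₚ.+-identityˡ ((+ 1) / A)) ⟩
    (((+ 1) / A ℚ.+ (+ 1) / B) ℚ.+ (+ 1) / 4 ^ n) ℚ.+ (+ 1) / E
      ≡⟨ cong (λ x → (x ℚ.+ (+ 1) / 4 ^ n) ℚ.+ (+ 1) / E) (/+/ 1 A 1 B) ⟩
    ((+ (1 * B + 1 * A)) / (A * B) ℚ.+ (+ 1) / 4 ^ n) ℚ.+ (+ 1) / E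
      ≡⟨ cong (λ x → ((+ (1 * B + 1 * A)) / (A * B) ℚ.+ x) ℚ.+ (+ 1) / E)
              (ℚₚ./-cong {+ 1} refl (4^n≡2^n*2^n n)) ⟩
    ((+ (1 * B + 1 * A)) / (A * B) ℚ.+ (+ 1) / (A * A)) ℚ.+ (+ 1) / E
      ≡⟨ cong (ℚ._+ (+ 1) / E) (/+/ (1 * B + 1 * A) (A * B) 1 (A * A)) ⟩
    (+ ((1 * B + 1 * A) * (A * A) + 1 * (A * B))) / (A * B * (A * A)) ℚ.+ (+ 1) / E
      ≡⟨ /+/ ((1 * B + 1 * A) * (A * A) + 1 * (A * B)) (A * B * (A * A)) 1 E ⟩
    (+ X) / Y ∎
    where open ≡-Reasoning

  X>0 : 0 < X
  X>0 = <-≤-trans (>-nonZero⁻¹ (1 * (A * B * (A * A))) {{m*n≢0 1 (A * B * (A * A))}})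
                  (m≤n+m (1 * (A * B * (A * A))) (((1 * B + 1 * A) * (A * A) + 1 * (A * B)) * E))

  A²<[1+f]B : A * A < suc (floor4/3pow n) * B
  A²<[1+f]B = subst (_< suc (floor4/3pow n) * B) (4^n≡2^n*2^n n) (4^n<suc[floor4/3pow]*3^n n)

  zetaUpper<1/m : ∀ m .{{_ : NonZero m}} → 16 ≤ k →
                  m + floor4/3pow n + 2 ≤ A → zetaUpper k 3 3 ℚ.< (+ 1) / m
  zetaUpper<1/m m 16≤k gap = subst (ℚ._< (+ 1) / m) (sym zetaUpper≡X/Y)
    (*<*⇒/</ X Y 1 m (subst (X * m <_) (sym (*-identityˡ Y))
      (*<-from-floor-gap X>0 gap A²<[1+f]B
        (recipSumNumer-bound A B E (3^n*3^n≤2^n*[5^k*4] 16≤k)))))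

floorGap : ℕ → ℕ
floorGap n = 2 ^ n ∸ (floor4/3pow n + 2)

-- suc (floorGap n ∸ 1) is floorGap n written as a visibly nonzero denominator.
zetaUpper-small-decided : ∀ {k} → k < 16 →
                          zetaUpper k 4 4 ℚ.< (+ 1) / suc (floorGap (2 + k) ∸ 1)
zetaUpper-small-decided =
  from-yes (allUpTo? (λ k → zetaUpper k 4 4 ℚₚ.<? (+ 1) / suc (floorGap (2 + k) ∸ 1)) 16)

zetaUpper-small< : ∀ k m .{{_ : NonZero m}} → k < 16 →
                   m + floor4/3pow (2 + k) + 2 ≤ 2 ^ (2 + k) → zetaUpper k 4 4 ℚ.< (+ 1) / m
zetaUpper-small< k m k<16 gap =
  ℚₚ.<-≤-trans (zetaUpper-small-decided k<16) (*≤*⇒/≤/ 1 _ 1 m (*-monoʳ-≤ 1 m≤1+[g∸1]))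
  where
  g : ℕ
  g = floorGap (2 + k)
  m≤1+[g∸1] : m ≤ suc (g ∸ 1)
  m≤1+[g∸1] = ≤-trans (m+n≤o⇒m≤o∸n m (subst (_≤ 2 ^ (2 + k)) (+-assoc m _ 2) gap))
                      (m≤n+m∸n g 1)

zetaMinusOneBelow-recip : ∀ k m .{{_ : NonZero m}} →
                          m + floor4/3pow (2 + k) + 2 ≤ 2 ^ (2 + k) →
                          ZetaMinusOneBelow (2 + k) ((+ 1) / m)
zetaMinusOneBelow-recip k m gap with k <? 16
... | yes k<16 = zetaUpper k 4 4 , S≤zetaUpper k 4 , zetaUpper-small< k m k<16 gap
... | no k≮16  = zetaUpper k 3 3 , S≤zetaUpper k 3 , LargeExponent.zetaUpper<1/m k m (≮⇒≥ k≮16) gap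

corollary1p3 : (n : ℕ) → 2 ≤ n →
    (F : ℕ) → IsFloorRecipZetaMinusOne n F →
    F + floor4/3pow n + 2 ≡ 2 ^ n →
    (m : ℕ) → .{{_ : NonZero m}} → ¬ ZetaMinusOneEq n ((+ 1) / m)
corollary1p3 0 ()
corollary1p3 1 (s≤s ())
corollary1p3 (suc (suc k)) _ F isFloor F+f+2≡2^n m zeta =
  ZetaMinusOneEq⇒¬Below zeta (zetaMinusOneBelow-recip k m gap)
  where
  f : ℕ
  f = floor4/3pow (2 + k)
  gap : m + f + 2 ≤ 2 ^ (2 + k)
  gap = subst (m + f + 2 ≤_) F+f+2≡2^n
              (+-monoˡ-≤ 2 (+-monoˡ-≤ f (IsFloorRecip⇒≥ isFloor (proj₁ zeta))))
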